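{- Suppose $L=M\mathbin{\Join} N$ where $M$ is a matroid on $A$, $N$ a matroid on $B$, $(M,N)$ matched, and $E=A\cup B$. If $A'\subseteq A$ and $B'\subseteq B$ satisfy $A'\cup B'=E$, then $(A',B')$ is a free separator of $L$ if and only if $(A',A\cap B')$ is a free separator of $M$ and $(A'\cap B,B')$ is a free separator of $N$.
   Context: $M.X$ is contraction of $M$ to $X$ (i.e. $M/(E-X)$), $M|X$ restriction. $M(A)$, $N(B)$ matched means $M.(A\cap B)=N|(A\cap B)$. Free splice $M\mathbin{\Join} N$: matroid on $A\cup B$ with rank $r(X)=\min\{r_M(X\cap A)+|X-A|,\ r_N(X\cap B)+r_M(A-B)\}$. For a matroid $K$ on $E$ and $C,D\subseteq E$ with $C\cup D=E$, $(C,D)$ is a free separator of $K$ if $K=K|C\mathbin{\Join} K.D$. -}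

module Defs where

open import Data.Nat using (ℕ; _+_; _∸_; _≤_; _⊓_)
open import Data.Fin.Subset using (Subset; _⊆_; _∩_; _∪_; _─_; ∣_∣)

-- A matroid on ground set E is a rank function (only its values on subsets
-- of E are meaningful) satisfying the standard rank axioms on subsets of E.
record Matroid (n : ℕ) : Set where
  field
    ground : Subset n
    rank   : Subset n → ℕ
    rank-bounded : ∀ X → X ⊆ ground → rank X ≤ ∣ X ∣
    rank-mono    : ∀ X Y → X ⊆ Y → Y ⊆ ground → rank X ≤ rank Y
    rank-submod  : ∀ X Y → X ⊆ ground → Y ⊆ ground →
                   rank (X ∪ Y) + rank (X ∩ Y) ≤ rank X + rank Y

-- Rank function of the contraction K.D = K/(E-D) of a matroid with ground
-- set E and rank function r, on subsets Y ⊆ D.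
contractRank : ∀ {n} → (Subset n → ℕ) → Subset n → Subset n → Subset n → ℕ
contractRank r E D Y = r (Y ∪ (E ─ D)) ∸ r (E ─ D)

spliceRank : ∀ {n} → (Subset n → ℕ) → Subset n → (Subset n → ℕ) → Subset n →
             Subset n → ℕ
spliceRank rM A rN B X = (rM (X ∩ A) + ∣ X ─ A ∣) ⊓ (rN (X ∩ B) + rM (A ─ B))

-- (M,N) matched: M.(A∩B) = N|(A∩B), i.e. equal rank on all subsets of A∩B.
Matched : ∀ {n} → Matroid n → Matroid n → Set
Matched M N = ∀ Y → Y ⊆ (A ∩ B) →
  contractRank (Matroid.rank M) A (A ∩ B) Y ≡ℕ Matroid.rank N Y
  where
    open import Relation.Binary.PropositionalEquality renaming (_≡_ to _≡ℕ_)
    A = Matroid.ground M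
    B = Matroid.ground N

-- (C,D) is a free separator of the matroid with ground set E and rank r
-- (assuming C ∪ D = E, imposed separately): K = K|C ⋈ K.D, i.e. the rank
-- functions agree on all subsets of E.
IsFreeSeparator : ∀ {n} → (Subset n → ℕ) → Subset n → Subset n → Subset n → Set
IsFreeSeparator r E C D = ∀ X → X ⊆ E →
  r X ≡ spliceRank r C (contractRank r E D) D X
  where open import Relation.Binary.PropositionalEquality using (_≡_)

-- The splice L = M ⋈ N agrees with M on subsets of A, and on Y ∪ (A ─ B) with Y ⊆ B it is
-- rN Y + rM (A ─ B).  All ranks involved are monotone, so the contraction term in the definition
-- of a free separator (C,D) collapses and the condition reads
--   r X = min (r (X ∩ C) + |X ─ C|, r ((X ∩ D) ∪ (C ─ D)))   for X ⊆ C ∪ D.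
-- Evaluating this identity for L at X ⊆ A, and at X ∪ (A ─ B) for X ⊆ B, yields the identities
-- for M and N.  Conversely rL X is the minimum of an M-term and an N-term; the identities for M
-- and N bound the right-hand side for L by each of them, and monotonicity gives the other bound.
module Submission where

open import Defs
open import Data.Nat using (ℕ)
open import Data.Product using (_×_)
open import Data.Fin.Subset using (Subset; _⊆_; _∩_; _∪_)
open import Function.Bundles using (_⇔_)
open import Relation.Binary.PropositionalEquality using (_≡_)

-- Boolean combinations of k subsets are equal iff they agree at every point, and a point only
-- matters through its membership profile in Vec Bool k.  So an identity under inclusion
-- hypotheses is decided by checking the 2^k profiles, and 'set-≡' / 'set-⊆' discharge the
-- decision as an implicit 'True' argument by evaluation.
module SubsetSolver where

  open import Data.Nat using (zero; suc)
  open import Data.Bool using (Bool; true; false; _∧_; _∨_; not; T)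
  open import Data.Bool.Properties using (T?; ∧-identityʳ; ∧-zeroʳ) renaming (_≟_ to _≟ᵇ_)
  open import Data.Unit using (tt)
  open import Data.Fin using (Fin; zero; suc)
  open import Data.Fin.Subset using (_─_; ⊥; _∈_)
  open import Data.Fin.Subset.Properties using (p∩q⊆q)
  open import Data.List using (List)
  open import Data.List.Relation.Unary.All as All using (All; all?)
  open import Data.Product using (_,_)
  open import Data.Vec using (Vec; []; _∷_; lookup; map)
  open import Data.Vec.Properties
    using (lookup-map; lookup-zipWith; lookup-replicate; []=⇒lookup; lookup⇒[]=; tabulate∘lookup; tabulate-cong)
  open import Function using (_∘_; _$_)
  open import Relation.Nullary.Decidable using (Dec; True; toWitness; map′; _×-dec_; _→-dec_)
  open import Relation.Binary.PropositionalEquality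

  private
    variable
      k n : ℕ

  infixr 9 _∩ₜ_
  infixr 8 _∪ₜ_
  infixl 7 _─ₜ_
  infix 6 _⊆ₜ_

  data Term (k : ℕ) : Set where
    var : Fin k → Term k
    ∅ₜ : Term k
    _∩ₜ_ _∪ₜ_ _─ₜ_ : Term k → Term k → Term k

  ⟦_⟧ : Term k → Vec (Subset n) k → Subset n
  ⟦ var i ⟧ ρ = lookup ρ i
  ⟦ ∅ₜ ⟧ ρ = ⊥
  ⟦ t ∩ₜ u ⟧ ρ = ⟦ t ⟧ ρ ∩ ⟦ u ⟧ ρ
  ⟦ t ∪ₜ u ⟧ ρ = ⟦ t ⟧ ρ ∪ ⟦ u ⟧ ρ
  ⟦ t ─ₜ u ⟧ ρ = ⟦ t ⟧ ρ ─ ⟦ u ⟧ ρ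

  ⟦_⟧ᵇ : Term k → Vec Bool k → Bool
  ⟦ var i ⟧ᵇ v = lookup v i
  ⟦ ∅ₜ ⟧ᵇ v = false
  ⟦ t ∩ₜ u ⟧ᵇ v = ⟦ t ⟧ᵇ v ∧ ⟦ u ⟧ᵇ v
  ⟦ t ∪ₜ u ⟧ᵇ v = ⟦ t ⟧ᵇ v ∨ ⟦ u ⟧ᵇ v
  ⟦ t ─ₜ u ⟧ᵇ v = ⟦ t ⟧ᵇ v ∧ not (⟦ u ⟧ᵇ v)

  record Inclusion (k : ℕ) : Set where
    constructor _⊆ₜ_
    field
      smaller larger : Term k

  Holds : Vec (Subset n) k → Inclusion k → Set
  Holds ρ (t ⊆ₜ u) = ⟦ t ⟧ ρ ⊆ ⟦ u ⟧ ρ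

  Holdsᵇ : Vec Bool k → Inclusion k → Set
  Holdsᵇ v (t ⊆ₜ u) = T (not (⟦ t ⟧ᵇ v) ∨ ⟦ u ⟧ᵇ v)

  Entails : List (Inclusion k) → Term k → Term k → Set
  Entails hs t u = ∀ v → All (Holdsᵇ v) hs → ⟦ t ⟧ᵇ v ≡ ⟦ u ⟧ᵇ v

  ∀-valuation? : {P : Vec Bool k → Set} → (∀ v → Dec (P v)) → Dec (∀ v → P v)
  ∀-valuation? {zero} P? = map′ (λ p → λ { [] → p }) (_$ []) (P? [])
  ∀-valuation? {suc k} P? =
    map′ (λ (p , q) → λ { (true ∷ v) → p v ; (false ∷ v) → q v })
         (λ f → f ∘ (true ∷_) , f ∘ (false ∷_))
         (∀-valuation? (P? ∘ (true ∷_)) ×-dec ∀-valuation? (P? ∘ (false ∷_)))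

  entails? : (hs : List (Inclusion k)) (t u : Term k) → Dec (Entails hs t u)
  entails? hs t u = ∀-valuation? λ v → all? (holdsᵇ? v) hs →-dec (⟦ t ⟧ᵇ v ≟ᵇ ⟦ u ⟧ᵇ v)
    where
    holdsᵇ? : ∀ v h → Dec (Holdsᵇ v h)
    holdsᵇ? v (t ⊆ₜ u) = T? (not (⟦ t ⟧ᵇ v) ∨ ⟦ u ⟧ᵇ v)

  profile : Vec (Subset n) k → Fin n → Vec Bool k
  profile ρ i = map (λ p → lookup p i) ρ

  lookup-─ : ∀ (p q : Subset n) i → lookup (p ─ q) i ≡ lookup p i ∧ not (lookup q i)
  lookup-─ (x ∷ p) (false ∷ q) zero = sym (∧-identityʳ x)
  lookup-─ (x ∷ p) (true ∷ q) zero = sym (∧-zeroʳ x)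
  lookup-─ (_ ∷ p) (_ ∷ q) (suc i) = lookup-─ p q i

  lookup-⟦⟧ : ∀ (t : Term k) (ρ : Vec (Subset n) k) i → lookup (⟦ t ⟧ ρ) i ≡ ⟦ t ⟧ᵇ (profile ρ i)
  lookup-⟦⟧ (var j) ρ i = sym (lookup-map j _ ρ)
  lookup-⟦⟧ ∅ₜ ρ i = lookup-replicate i false
  lookup-⟦⟧ (t ∩ₜ u) ρ i = trans (lookup-zipWith _∧_ i (⟦ t ⟧ ρ) (⟦ u ⟧ ρ))
                                (cong₂ _∧_ (lookup-⟦⟧ t ρ i) (lookup-⟦⟧ u ρ i))
  lookup-⟦⟧ (t ∪ₜ u) ρ i = trans (lookup-zipWith _∨_ i (⟦ t ⟧ ρ) (⟦ u ⟧ ρ))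
                                (cong₂ _∨_ (lookup-⟦⟧ t ρ i) (lookup-⟦⟧ u ρ i))
  lookup-⟦⟧ (t ─ₜ u) ρ i = trans (lookup-─ (⟦ t ⟧ ρ) (⟦ u ⟧ ρ) i)
                                (cong₂ (λ x y → x ∧ not y) (lookup-⟦⟧ t ρ i) (lookup-⟦⟧ u ρ i))

  ⊆⇒lookup : ∀ {p q : Subset n} → p ⊆ q → ∀ i → T (not (lookup p i) ∨ lookup q i)
  ⊆⇒lookup {p = p} p⊆q i with lookup p i in eq
  ... | false = tt
  ... | true rewrite []=⇒lookup (p⊆q (lookup⇒[]= i p eq)) = tt

  holds⇒holdsᵇ : ∀ (ρ : Vec (Subset n) k) i {h} → Holds ρ h → Holdsᵇ (profile ρ i) h
  holds⇒holdsᵇ ρ i {t ⊆ₜ u} t⊆u =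
    subst T (cong₂ (λ x y → not x ∨ y) (lookup-⟦⟧ t ρ i) (lookup-⟦⟧ u ρ i)) (⊆⇒lookup t⊆u i)

  lookup-extensionality : ∀ {p q : Subset n} → (∀ i → lookup p i ≡ lookup q i) → p ≡ q
  lookup-extensionality {p = p} {q} eq =
    trans (sym (tabulate∘lookup p)) (trans (tabulate-cong eq) (tabulate∘lookup q))

  module SetIdentities (ρ : Vec (Subset n) k) (hs : List (Inclusion k)) (hyps : All (Holds ρ) hs) where

    set-≡ : (t u : Term k) {_ : True (entails? hs t u)} → ⟦ t ⟧ ρ ≡ ⟦ u ⟧ ρ
    set-≡ t u {valid} = lookup-extensionality λ i →
      trans (lookup-⟦⟧ t ρ i)
        (trans (toWitness valid (profile ρ i) (All.map (λ {h} → holds⇒holdsᵇ ρ i {h}) hyps))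
               (sym (lookup-⟦⟧ u ρ i)))

    set-⊆ : (t u : Term k) {_ : True (entails? hs t (t ∩ₜ u))} → ⟦ t ⟧ ρ ⊆ ⟦ u ⟧ ρ
    set-⊆ t u {valid} i∈t = p∩q⊆q (⟦ t ⟧ ρ) (⟦ u ⟧ ρ) (subst (_ ∈_) (set-≡ t (t ∩ₜ u) {valid}) i∈t)

open import Data.Nat using (suc; _+_; _∸_; _≤_; _⊓_)
open import Data.Nat.Properties
  using (+-suc; +-assoc; +-distribʳ-⊓; +-mono-≤; +-monoˡ-≤; +-monoʳ-≤; +-identityʳ; +-cancelʳ-≡;
         m≤m+n; m∸n+n≡m; m≤n⇒m⊓n≡m; m≥n⇒m⊓n≡n; m⊓n≤m; m⊓n≤n; ⊓-glb; ⊓-mono-≤; ≤-antisym; ≤-trans;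
         ≤-reflexive; +-commutativeSemigroup; module ≤-Reasoning)
open import Algebra.Properties.CommutativeSemigroup +-commutativeSemigroup using (xy∙z≈xz∙y)
open import Data.Bool using (true; false)
open import Data.Fin.Patterns using (0F; 1F; 2F; 3F; 4F)
open import Data.Fin.Subset using (_─_; ∣_∣; ⊥)
open import Data.Fin.Subset.Properties using (⊆-trans; ⊆-reflexive; p∩q⊆q; p⊆q⇒∣p∣≤∣q∣; ∣⊥∣≡0)
open import Data.List using (List; []; _∷_)
open import Data.List.Relation.Unary.All using (All; []; _∷_)
open import Data.Product using (_,_)
open import Data.Vec using (Vec; []; _∷_; tail)
open import Function.Bundles using (mk⇔; Equivalence)
open Equivalence using (to; from)
open import Relation.Binary.PropositionalEquality using (refl; sym; trans; cong; cong₂; subst; module ≡-Reasoning)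
open SubsetSolver

private
  variable
    n : ℕ

∣p∪q∣≡∣p∣+∣q∣ : ∀ (p q : Subset n) → p ∩ q ≡ ⊥ → ∣ p ∪ q ∣ ≡ ∣ p ∣ + ∣ q ∣
∣p∪q∣≡∣p∣+∣q∣ [] [] _ = refl
∣p∪q∣≡∣p∣+∣q∣ (true ∷ p) (false ∷ q) p∩q≡⊥ = cong suc (∣p∪q∣≡∣p∣+∣q∣ p q (cong tail p∩q≡⊥))
∣p∪q∣≡∣p∣+∣q∣ (false ∷ p) (true ∷ q) p∩q≡⊥ =
  trans (cong suc (∣p∪q∣≡∣p∣+∣q∣ p q (cong tail p∩q≡⊥))) (sym (+-suc ∣ p ∣ ∣ q ∣))
∣p∪q∣≡∣p∣+∣q∣ (false ∷ p) (false ∷ q) p∩q≡⊥ = ∣p∪q∣≡∣p∣+∣q∣ p q (cong tail p∩q≡⊥)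

∩-monoˡ-⊆ : ∀ {p q : Subset n} r → p ⊆ q → p ∩ r ⊆ q ∩ r
∩-monoˡ-⊆ {p = p} {q} r p⊆q = set-⊆ (var 0F ∩ₜ var 2F) (var 1F ∩ₜ var 2F)
  where open SetIdentities (p ∷ q ∷ r ∷ []) (var 0F ⊆ₜ var 1F ∷ []) (p⊆q ∷ [])

─-monoˡ-⊆ : ∀ {p q : Subset n} r → p ⊆ q → p ─ r ⊆ q ─ r
─-monoˡ-⊆ {p = p} {q} r p⊆q = set-⊆ (var 0F ─ₜ var 2F) (var 1F ─ₜ var 2F)
  where open SetIdentities (p ∷ q ∷ r ∷ []) (var 0F ⊆ₜ var 1F ∷ []) (p⊆q ∷ [])

⊓-≤-+ : ∀ {x y p q k} → x ≤ p + k → y ≤ q + k → x ⊓ y ≤ p ⊓ q + k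
⊓-≤-+ {p = p} {q} {k} x≤ y≤ = subst (_ ≤_) (sym (+-distribʳ-⊓ k p q)) (⊓-mono-≤ x≤ y≤)

RankMonotone : (Subset n → ℕ) → Subset n → Set
RankMonotone r E = ∀ X Y → X ⊆ Y → Y ⊆ E → r X ≤ r Y

rank≤rank∩+∣─∣ : (K : Matroid n) → ∀ {Y} C → Y ⊆ Matroid.ground K →
                 Matroid.rank K Y ≤ Matroid.rank K (Y ∩ C) + ∣ Y ─ C ∣
rank≤rank∩+∣─∣ K {Y} C Y⊆E = begin
  r Y                                         ≡⟨ cong r (set-≡ y ((y ∩ₜ c) ∪ₜ (y ─ₜ c))) ⟩
  r ((Y ∩ C) ∪ (Y ─ C))                        ≤⟨ m≤m+n _ _ ⟩
  r ((Y ∩ C) ∪ (Y ─ C)) + r ((Y ∩ C) ∩ (Y ─ C))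
    ≤⟨ rank-submod (Y ∩ C) (Y ─ C) (⊆-trans (set-⊆ (y ∩ₜ c) y) Y⊆E) Y─C⊆E ⟩
  r (Y ∩ C) + r (Y ─ C)                        ≤⟨ +-monoʳ-≤ (r (Y ∩ C)) (rank-bounded (Y ─ C) Y─C⊆E) ⟩
  r (Y ∩ C) + ∣ Y ─ C ∣                        ∎
  where
  open Matroid K renaming (rank to r)
  open ≤-Reasoning
  open SetIdentities (Y ∷ C ∷ []) [] []
  y c : Term 2
  y = var 0F
  c = var 1F
  Y─C⊆E : Y ─ C ⊆ Matroid.ground K
  Y─C⊆E = ⊆-trans (set-⊆ (y ─ₜ c) y) Y⊆E

-- When C ∪ D = E and r is monotone, the rank of K|C ⋈ K.D simplifies to this.
separatorRank : (Subset n → ℕ) → Subset n → Subset n → Subset n → ℕ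
separatorRank r C D X = (r (X ∩ C) + ∣ X ─ C ∣) ⊓ r ((X ∩ D) ∪ (C ─ D))

FreeSeparation : (Subset n → ℕ) → Subset n → Subset n → Subset n → Set
FreeSeparation r E C D = ∀ X → X ⊆ E → r X ≡ separatorRank r C D X

spliceRank-contractRank : ∀ {r : Subset n → ℕ} {C D} → RankMonotone r (C ∪ D) → ∀ X →
  spliceRank r C (contractRank r (C ∪ D) D) D X ≡ separatorRank r C D X
spliceRank-contractRank {r = r} {C} {D} mono X =
  cong ((r (X ∩ C) + ∣ X ─ C ∣) ⊓_) (begin
    r ((X ∩ D) ∪ (C ∪ D ─ D)) ∸ r (C ∪ D ─ D) + r (C ─ D)
      ≡⟨ cong (λ Z → r ((X ∩ D) ∪ Z) ∸ r Z + r (C ─ D)) (set-≡ (c ∪ₜ d ─ₜ d) (c ─ₜ d)) ⟩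
    r ((X ∩ D) ∪ (C ─ D)) ∸ r (C ─ D) + r (C ─ D)
      ≡⟨ m∸n+n≡m (mono _ _ (set-⊆ (c ─ₜ d) ((x ∩ₜ d) ∪ₜ (c ─ₜ d))) (set-⊆ ((x ∩ₜ d) ∪ₜ (c ─ₜ d)) (c ∪ₜ d))) ⟩
    r ((X ∩ D) ∪ (C ─ D)) ∎)
  where
  open ≡-Reasoning
  open SetIdentities (X ∷ C ∷ D ∷ []) [] []
  x c d : Term 3
  x = var 0F
  c = var 1F
  d = var 2F

isFreeSeparator⇔freeSeparation : ∀ {r : Subset n → ℕ} {E C D} → RankMonotone r E → C ∪ D ≡ E →
  IsFreeSeparator r E C D ⇔ FreeSeparation r E C D
isFreeSeparator⇔freeSeparation mono refl = mk⇔
  (λ sep X X⊆E → trans (sep X X⊆E) (spliceRank-contractRank mono X))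
  (λ sep X X⊆E → trans (sep X X⊆E) (sym (spliceRank-contractRank mono X)))

module FreeSplice (M N : Matroid n) (matched : Matched M N) where

  open Matroid M using () renaming (ground to A; rank to rM; rank-mono to rM-mono)
  open Matroid N using () renaming (ground to B; rank to rN; rank-mono to rN-mono)

  s : ℕ
  s = rM (A ─ B)

  rL : Subset n → ℕ
  rL = spliceRank rM A rN B

  private
    x a b : Term 3
    x = var 0F
    a = var 1F
    b = var 2F

  rank-matched : ∀ {Y} → Y ⊆ A ∩ B → rM (Y ∪ (A ─ B)) ≡ rN Y + s
  rank-matched {Y} Y⊆A∩B = begin
    rM (Y ∪ (A ─ B))                          ≡⟨ m∸n+n≡m s≤ ⟨
    rM (Y ∪ (A ─ B)) ∸ s + s                  ≡⟨ cong (λ Z → rM (Y ∪ Z) ∸ rM Z + s) (set-≡ (a ─ₜ a ∩ₜ b) (a ─ₜ b)) ⟨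
    rM (Y ∪ (A ─ A ∩ B)) ∸ rM (A ─ A ∩ B) + s ≡⟨ cong (_+ s) (matched Y Y⊆A∩B) ⟩
    rN Y + s                                  ∎
    where
    open ≡-Reasoning
    open SetIdentities (Y ∷ A ∷ B ∷ []) (x ⊆ₜ a ∩ₜ b ∷ []) (Y⊆A∩B ∷ [])
    s≤ : s ≤ rM (Y ∪ (A ─ B))
    s≤ = rM-mono _ _ (set-⊆ (a ─ₜ b) (x ∪ₜ (a ─ₜ b))) (set-⊆ (x ∪ₜ (a ─ₜ b)) a)

  spliceRank-mono : ∀ {X Y} → X ⊆ Y → rL X ≤ rL Y
  spliceRank-mono {X} {Y} X⊆Y = ⊓-mono-≤
    (+-mono-≤ (rM-mono _ _ (∩-monoˡ-⊆ A X⊆Y) (p∩q⊆q Y A)) (p⊆q⇒∣p∣≤∣q∣ (─-monoˡ-⊆ A X⊆Y)))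
    (+-monoˡ-≤ s (rN-mono _ _ (∩-monoˡ-⊆ B X⊆Y) (p∩q⊆q Y B)))

  spliceRank-restriction : ∀ {X} → X ⊆ A → rL X ≡ rM X
  spliceRank-restriction {X} X⊆A = begin
    (rM (X ∩ A) + ∣ X ─ A ∣) ⊓ (rN (X ∩ B) + s) ≡⟨ cong (_⊓ (rN (X ∩ B) + s)) first≡ ⟩
    rM X ⊓ (rN (X ∩ B) + s)                     ≡⟨ m≤n⇒m⊓n≡m rM≤second ⟩
    rM X                                        ∎
    where
    open ≡-Reasoning
    open SetIdentities (X ∷ A ∷ B ∷ []) (x ⊆ₜ a ∷ []) (X⊆A ∷ [])
    first≡ : rM (X ∩ A) + ∣ X ─ A ∣ ≡ rM X
    first≡ = trans (cong₂ (λ P Q → rM P + ∣ Q ∣) (set-≡ (x ∩ₜ a) x) (set-≡ (x ─ₜ a) ∅ₜ))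
                   (trans (cong (rM X +_) (∣⊥∣≡0 n)) (+-identityʳ (rM X)))
    rM≤second : rM X ≤ rN (X ∩ B) + s
    rM≤second = subst (rM X ≤_) (rank-matched (set-⊆ (x ∩ₜ b) (a ∩ₜ b)))
      (rM-mono _ _ (set-⊆ x ((x ∩ₜ b) ∪ₜ (a ─ₜ b))) (set-⊆ ((x ∩ₜ b) ∪ₜ (a ─ₜ b)) a))

  spliceRank-contraction : ∀ {Y} → Y ⊆ B → rL (Y ∪ (A ─ B)) ≡ rN Y + s
  spliceRank-contraction {Y} Y⊆B =
    trans (cong (λ Z → (rM (Y′ ∩ A) + ∣ Y′ ─ A ∣) ⊓ (rN Z + s)) (set-≡ (y′ ∩ₜ b) x))
          (m≥n⇒m⊓n≡n second≤first)
    where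
    open SetIdentities (Y ∷ A ∷ B ∷ []) (x ⊆ₜ b ∷ []) (Y⊆B ∷ [])
    Y′ : Subset n
    Y′ = Y ∪ (A ─ B)
    y′ : Term 3
    y′ = x ∪ₜ (a ─ₜ b)
    second≤first : rN Y + s ≤ rM (Y′ ∩ A) + ∣ Y′ ─ A ∣
    second≤first = begin
      rN Y + s                              ≤⟨ +-monoˡ-≤ s (rank≤rank∩+∣─∣ N A Y⊆B) ⟩
      rN (Y ∩ A) + ∣ Y ─ A ∣ + s            ≡⟨ xy∙z≈xz∙y (rN (Y ∩ A)) ∣ Y ─ A ∣ s ⟩
      rN (Y ∩ A) + s + ∣ Y ─ A ∣            ≡⟨ cong (_+ ∣ Y ─ A ∣) (rank-matched (set-⊆ (x ∩ₜ a) (a ∩ₜ b))) ⟨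
      rM ((Y ∩ A) ∪ (A ─ B)) + ∣ Y ─ A ∣    ≡⟨ cong₂ (λ P Q → rM P + ∣ Q ∣) (set-≡ ((x ∩ₜ a) ∪ₜ (a ─ₜ b)) (y′ ∩ₜ a))
                                                                         (set-≡ (x ─ₜ a) (y′ ─ₜ a)) ⟩
      rM (Y′ ∩ A) + ∣ Y′ ─ A ∣              ∎
      where open ≤-Reasoning

module Separators (M N : Matroid n) (matched : Matched M N) (A' B' : Subset n)
  (A'⊆A : A' ⊆ Matroid.ground M) (B'⊆B : B' ⊆ Matroid.ground N)
  (cover : A' ∪ B' ≡ Matroid.ground M ∪ Matroid.ground N) where

  open FreeSplice M N matched
  open Matroid M using () renaming (ground to A; rank to rM)
  open Matroid N using () renaming (ground to B; rank to rN)

  E : Subset n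
  E = A ∪ B

  private
    x a b a′ b′ : Term 5
    x = var 0F
    a = var 1F
    b = var 2F
    a′ = var 3F
    b′ = var 4F

    layout : List (Inclusion 5)
    layout = a′ ⊆ₜ a ∷ b′ ⊆ₜ b ∷ a ∪ₜ b ⊆ₜ a′ ∪ₜ b′ ∷ []

    env : Subset n → Vec (Subset n) 5
    env X = X ∷ A ∷ B ∷ A' ∷ B' ∷ []

    layout-holds : ∀ X → All (Holds (env X)) layout
    layout-holds X = A'⊆A ∷ B'⊆B ∷ ⊆-reflexive (sym cover) ∷ []

  cover-M : A' ∪ A ∩ B' ≡ A
  cover-M = set-≡ (a′ ∪ₜ a ∩ₜ b′) a
    where open SetIdentities (env ⊥) layout (layout-holds ⊥)

  cover-N : A' ∩ B ∪ B' ≡ B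
  cover-N = set-≡ (a′ ∩ₜ b ∪ₜ b′) b
    where open SetIdentities (env ⊥) layout (layout-holds ⊥)

  free-L⇒M : FreeSeparation rL E A' B' → FreeSeparation rM A A' (A ∩ B')
  free-L⇒M free-L X X⊆A = begin
    rM X                                                       ≡⟨ spliceRank-restriction X⊆A ⟨
    rL X                                                       ≡⟨ free-L X (set-⊆ x (a ∪ₜ b)) ⟩
    (rL (X ∩ A') + ∣ X ─ A' ∣) ⊓ rL ((X ∩ B') ∪ (A' ─ B'))
      ≡⟨ cong₂ _⊓_ (cong (_+ ∣ X ─ A' ∣) (spliceRank-restriction (set-⊆ (x ∩ₜ a′) a)))
                   (trans (cong rL Z≡) (spliceRank-restriction (set-⊆ z a))) ⟩
    separatorRank rM A' (A ∩ B') X                             ∎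
    where
    open ≡-Reasoning
    open SetIdentities (env X) (x ⊆ₜ a ∷ layout) (X⊆A ∷ layout-holds X)
    z : Term 5
    z = (x ∩ₜ (a ∩ₜ b′)) ∪ₜ (a′ ─ₜ a ∩ₜ b′)
    Z≡ : (X ∩ B') ∪ (A' ─ B') ≡ ⟦ z ⟧ (env X)
    Z≡ = set-≡ ((x ∩ₜ b′) ∪ₜ (a′ ─ₜ b′)) z

  -- Evaluate the identity for L at X ∪ (A ─ B); every rank on the way is shifted by s.
  free-L⇒N : FreeSeparation rL E A' B' → FreeSeparation rN B (A' ∩ B) B'
  free-L⇒N free-L X X⊆B = +-cancelʳ-≡ s _ _ (begin
    rN X + s                                                   ≡⟨ spliceRank-contraction X⊆B ⟨
    rL X′                                                      ≡⟨ free-L X′ (set-⊆ x′ (a ∪ₜ b)) ⟩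
    (rL (X′ ∩ A') + ∣ X′ ─ A' ∣) ⊓ rL ((X′ ∩ B') ∪ (A' ─ B'))
      ≡⟨ cong₂ _⊓_ (cong₂ _+_ (trans (cong rL (set-≡ (x′ ∩ₜ a′) (p ∪ₜ (a ─ₜ b))))
                                       (spliceRank-contraction (set-⊆ p b)))
                              (cong ∣_∣ (set-≡ (x′ ─ₜ a′) (x ─ₜ a′ ∩ₜ b))))
                   (trans (cong rL (set-≡ ((x′ ∩ₜ b′) ∪ₜ (a′ ─ₜ b′)) (q ∪ₜ (a ─ₜ b))))
                          (spliceRank-contraction (set-⊆ q b))) ⟩
    (rN P + s + ∣ X ─ A' ∩ B ∣) ⊓ (rN Q + s)                  ≡⟨ cong (_⊓ (rN Q + s)) (xy∙z≈xz∙y (rN P) s _) ⟩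
    (rN P + ∣ X ─ A' ∩ B ∣ + s) ⊓ (rN Q + s)                  ≡⟨ +-distribʳ-⊓ s _ _ ⟨
    separatorRank rN (A' ∩ B) B' X + s                         ∎)
    where
    open ≡-Reasoning
    open SetIdentities (env X) (x ⊆ₜ b ∷ layout) (X⊆B ∷ layout-holds X)
    x′ p q : Term 5
    x′ = x ∪ₜ (a ─ₜ b)
    p = x ∩ₜ (a′ ∩ₜ b)
    q = (x ∩ₜ b′) ∪ₜ (a′ ∩ₜ b ─ₜ b′)
    X′ P Q : Subset n
    X′ = X ∪ (A ─ B)
    P = ⟦ p ⟧ (env X)
    Q = ⟦ q ⟧ (env X)

  module _ {X} (X⊆E : X ⊆ E) where

    private
      open SetIdentities (env X) (x ⊆ₜ a ∪ₜ b ∷ layout) (X⊆E ∷ layout-holds X)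
      XA Z : Subset n
      XA = X ∩ A
      Z = (X ∩ B') ∪ (A' ─ B')
      z : Term 5
      z = (x ∩ₜ b′) ∪ₜ (a′ ─ₜ b′)
      m₁ m₂ : ℕ
      m₁ = rM (XA ∩ A') + ∣ XA ─ A' ∣
      m₂ = rM ((XA ∩ (A ∩ B')) ∪ (A' ─ A ∩ B'))

      first≡ : rL (X ∩ A') + ∣ X ─ A' ∣ ≡ m₁ + ∣ X ─ A ∣
      first≡ = begin
        rL (X ∩ A') + ∣ X ─ A' ∣
          ≡⟨ cong₂ _+_ (trans (spliceRank-restriction (set-⊆ (x ∩ₜ a′) a))
                              (cong rM (set-≡ (x ∩ₜ a′) ((x ∩ₜ a) ∩ₜ a′))))
                       (cong ∣_∣ (set-≡ (x ─ₜ a′) ((x ∩ₜ a ─ₜ a′) ∪ₜ (x ─ₜ a)))) ⟩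
        rM (XA ∩ A') + ∣ (XA ─ A') ∪ (X ─ A) ∣
          ≡⟨ cong (rM (XA ∩ A') +_) (∣p∪q∣≡∣p∣+∣q∣ _ _ (set-≡ ((x ∩ₜ a ─ₜ a′) ∩ₜ (x ─ₜ a)) ∅ₜ)) ⟩
        rM (XA ∩ A') + (∣ XA ─ A' ∣ + ∣ X ─ A ∣)
          ≡⟨ +-assoc (rM (XA ∩ A')) _ _ ⟨
        m₁ + ∣ X ─ A ∣ ∎
        where open ≡-Reasoning

    spliceRank≤separatorRank : FreeSeparation rM A A' (A ∩ B') → rL X ≤ separatorRank rL A' B' X
    spliceRank≤separatorRank free-M = ⊓-glb
      (begin
        rL X                 ≤⟨ m⊓n≤m _ _ ⟩
        rM XA + ∣ X ─ A ∣    ≤⟨ +-monoˡ-≤ _ (subst (_≤ m₁) (sym (free-M XA (p∩q⊆q X A))) (m⊓n≤m _ _)) ⟩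
        m₁ + ∣ X ─ A ∣        ≡⟨ first≡ ⟨
        rL (X ∩ A') + ∣ X ─ A' ∣ ∎)
      (spliceRank-mono (set-⊆ x z))
      where open ≤-Reasoning

    separatorRank≤spliceRank : FreeSeparation rM A A' (A ∩ B') → FreeSeparation rN B (A' ∩ B) B' →
                               separatorRank rL A' B' X ≤ rL X
    separatorRank≤spliceRank free-M free-N = ⊓-glb bound-A bound-B
      where
      open ≤-Reasoning
      XB : Subset n
      XB = X ∩ B
      n₁ n₂ : ℕ
      n₁ = rN (XB ∩ (A' ∩ B)) + ∣ XB ─ A' ∩ B ∣
      n₂ = rN ((XB ∩ B') ∪ (A' ∩ B ─ B'))

      Z-in-A : rM (Z ∩ A) + ∣ Z ─ A ∣ ≡ m₂ + ∣ X ─ A ∣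
      Z-in-A = cong₂ (λ P Q → rM P + ∣ Q ∣)
        (set-≡ (z ∩ₜ a) (((x ∩ₜ a) ∩ₜ (a ∩ₜ b′)) ∪ₜ (a′ ─ₜ a ∩ₜ b′))) (set-≡ (z ─ₜ a) (x ─ₜ a))

      Z-in-B : rN (Z ∩ B) + s ≡ n₂ + s
      Z-in-B = cong (λ P → rN P + s) (set-≡ (z ∩ₜ b) (((x ∩ₜ b) ∩ₜ b′) ∪ₜ (a′ ∩ₜ b ─ₜ b′)))

      bound-A : separatorRank rL A' B' X ≤ rM XA + ∣ X ─ A ∣
      bound-A = begin
        separatorRank rL A' B' X
          ≤⟨ ⊓-≤-+ {p = m₁} {m₂} (≤-reflexive first≡) (≤-trans (m⊓n≤m _ _) (≤-reflexive Z-in-A)) ⟩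
        m₁ ⊓ m₂ + ∣ X ─ A ∣        ≡⟨ cong (_+ ∣ X ─ A ∣) (free-M XA (p∩q⊆q X A)) ⟨
        rM XA + ∣ X ─ A ∣          ∎

      first≤ : rL (X ∩ A') + ∣ X ─ A' ∣ ≤ n₁ + s
      first≤ = begin
        rL (X ∩ A') + ∣ X ─ A' ∣              ≤⟨ +-monoˡ-≤ ∣ X ─ A' ∣ (m⊓n≤n _ (rN ((X ∩ A') ∩ B) + s)) ⟩
        rN ((X ∩ A') ∩ B) + s + ∣ X ─ A' ∣    ≡⟨ xy∙z≈xz∙y (rN ((X ∩ A') ∩ B)) s ∣ X ─ A' ∣ ⟩
        rN ((X ∩ A') ∩ B) + ∣ X ─ A' ∣ + s    ≡⟨ cong₂ (λ P Q → rN P + ∣ Q ∣ + s)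
                                                  (set-≡ ((x ∩ₜ a′) ∩ₜ b) ((x ∩ₜ b) ∩ₜ (a′ ∩ₜ b)))
                                                  (set-≡ (x ─ₜ a′) (x ∩ₜ b ─ₜ a′ ∩ₜ b)) ⟩
        n₁ + s                                ∎

      bound-B : separatorRank rL A' B' X ≤ rN XB + s
      bound-B = begin
        separatorRank rL A' B' X  ≤⟨ ⊓-≤-+ {p = n₁} {n₂} first≤ (≤-trans (m⊓n≤n _ _) (≤-reflexive Z-in-B)) ⟩
        n₁ ⊓ n₂ + s                ≡⟨ cong (_+ s) (free-N XB (p∩q⊆q X B)) ⟨
        rN XB + s                  ∎

  free-MN⇒L : FreeSeparation rM A A' (A ∩ B') → FreeSeparation rN B (A' ∩ B) B' → FreeSeparation rL E A' B'
  free-MN⇒L free-M free-N X X⊆E =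
    ≤-antisym (spliceRank≤separatorRank X⊆E free-M) (separatorRank≤spliceRank X⊆E free-M free-N)

proposition4p8 : ∀ {n} (M N : Matroid n) → Matched M N →
    (A' B' : Subset n) → A' ⊆ Matroid.ground M → B' ⊆ Matroid.ground N →
    A' ∪ B' ≡ Matroid.ground M ∪ Matroid.ground N →
    IsFreeSeparator
      (spliceRank (Matroid.rank M) (Matroid.ground M) (Matroid.rank N) (Matroid.ground N))
      (Matroid.ground M ∪ Matroid.ground N) A' B'
    ⇔ (IsFreeSeparator (Matroid.rank M) (Matroid.ground M) A' (Matroid.ground M ∩ B')
       × IsFreeSeparator (Matroid.rank N) (Matroid.ground N) (A' ∩ Matroid.ground N) B')
proposition4p8 M N matched A' B' A'⊆A B'⊆B cover = mk⇔
  (λ sep-L → let free-L = to L⇔ sep-L in from M⇔ (free-L⇒M free-L) , from N⇔ (free-L⇒N free-L))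
  (λ (sep-M , sep-N) → from L⇔ (free-MN⇒L (to M⇔ sep-M) (to N⇔ sep-N)))
  where
  open Separators M N matched A' B' A'⊆A B'⊆B cover
  open FreeSplice M N matched using (rL; spliceRank-mono)
  open Matroid M using () renaming (ground to A; rank to rM; rank-mono to rM-mono)
  open Matroid N using () renaming (ground to B; rank to rN; rank-mono to rN-mono)
  L⇔ : IsFreeSeparator rL E A' B' ⇔ FreeSeparation rL E A' B'
  L⇔ = isFreeSeparator⇔freeSeparation (λ _ _ X⊆Y _ → spliceRank-mono X⊆Y) cover
  M⇔ : IsFreeSeparator rM A A' (A ∩ B') ⇔ FreeSeparation rM A A' (A ∩ B')
  M⇔ = isFreeSeparator⇔freeSeparation rM-mono cover-M
  N⇔ : IsFreeSeparator rN B (A' ∩ B) B' ⇔ FreeSeparation rN B (A' ∩ B) B'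
  N⇔ = isFreeSeparator⇔freeSeparation rN-mono cover-N
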